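{- Every $\Sigma$-formula $\phi$ is $\mathfrak{D}$-equivalent to an $\mathcal{L}_{BT}$-formula of the form $(Q_1^{t_1}v_1)\cdots(Q_m^{t_m}v_m)\,s=t$, where $s,t,t_1,\ldots,t_m$ are $\mathcal{L}_{BT}$-terms and each $Q_j^{t_j}v_j$ is one of $\exists v_j$, $(\exists v_j\preceq t_j)$, $(\forall v_j\preceq t_j)$ for $j=1,\ldots,m$. Moreover, if $\phi$ is purely existential, then every $Q_j^{t_j}v_j$ is $\exists v_j$ (i.e. $\phi$ is $\mathfrak{D}$-equivalent to a formula of the form $\exists v_1\ldots v_m[s=t]$).
   Context: Bit strings are elements of $\{\mathbf{0},\mathbf{1}\}^*$; $\varepsilon$ is the empty string. The language $\mathcal{L}_{BT}$ has constant symbols $e,0,1$, binary function symbol $\circ$, and binary relation symbol $\preceq$. The structure $\mathfrak{D}$ has universe $\{\mathbf{0},\mathbf{1}\}^*$, interprets $e,0,1$ as $\varepsilon,\mathbf{0},\mathbf{1}$, $\circ$ as concatenation, and $\preceq$ as the prefix relation. $(\exists x\preceq t)\phi$ abbreviates $\exists x[x\preceq t\wedge\phi]$, $(\forall x\preceq t)\phi$ abbreviates $\forall x[x\preceq t\to\phi]$. $\Sigma$-formulas: $s\preceq t$, $\neg s\preceq t$, $s=t$, $\neg s=t$ (terms $s,t$) are $\Sigma$-formulas; they are closed under $\wedge,\vee$, and under $(\exists x\preceq t)$, $(\forall x\preceq t)$ and $\exists x$ where $x$ does not occur in $t$. A purely existential formula is a $\Sigma$-formula with no bounded universal quantifiers.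 Two formulas are $\mathfrak{D}$-equivalent if their biconditional (universally closed) holds in $\mathfrak{D}$. -}

module Defs where

open import Data.Nat using (ℕ)
open import Data.Bool using (Bool; true; false)
open import Data.List using (List; []; _∷_; _++_)
open import Data.Product using (Σ; _×_; _,_)
open import Data.Sum using (_⊎_)
open import Data.Empty using (⊥)
open import Relation.Binary.PropositionalEquality using (_≡_)
open import Relation.Nullary using (¬_)
open import Function.Bundles using (_⇔_)

-- Bit strings: 𝟎 = false, 𝟏 = true, ε = []

BitString : Set
BitString = List Bool

_⊑_ : BitString → BitString → Set
x ⊑ y = Σ BitString (λ z → x ++ z ≡ y)

Var : Set
Var = ℕ

data Term : Set where
  var  : Var → Term
  e    : Term
  c0   : Term
  c1   : Term
  _∘ₜ_ : Term → Term → Term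

data Formula : Set where
  _≐_   : Term → Term → Formula
  _≼_   : Term → Term → Formula
  ¬ᶠ_   : Formula → Formula
  _∧ᶠ_  : Formula → Formula → Formula
  _∨ᶠ_  : Formula → Formula → Formula
  _⇒ᶠ_  : Formula → Formula → Formula
  ∃ᶠ    : Var → Formula → Formula
  ∀ᶠ    : Var → Formula → Formula

∃≼ : Var → Term → Formula → Formula
∃≼ x t φ = ∃ᶠ x ((var x ≼ t) ∧ᶠ φ)

∀≼ : Var → Term → Formula → Formula
∀≼ x t φ = ∀ᶠ x ((var x ≼ t) ⇒ᶠ φ)

data OccursIn (x : Var) : Term → Set where
  here : OccursIn x (var x)
  left  : ∀ {s t} → OccursIn x s → OccursIn x (s ∘ₜ t)
  right : ∀ {s t} → OccursIn x t → OccursIn x (s ∘ₜ t)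

data IsΣ : Formula → Set where
  eq    : ∀ s t → IsΣ (s ≐ t)
  pre   : ∀ s t → IsΣ (s ≼ t)
  neq   : ∀ s t → IsΣ (¬ᶠ (s ≐ t))
  npre  : ∀ s t → IsΣ (¬ᶠ (s ≼ t))
  and   : ∀ {φ ψ} → IsΣ φ → IsΣ ψ → IsΣ (φ ∧ᶠ ψ)
  or    : ∀ {φ ψ} → IsΣ φ → IsΣ ψ → IsΣ (φ ∨ᶠ ψ)
  bex   : ∀ x t {φ} → ¬ OccursIn x t → IsΣ φ → IsΣ (∃≼ x t φ)
  ball  : ∀ x t {φ} → ¬ OccursIn x t → IsΣ φ → IsΣ (∀≼ x t φ)
  ex    : ∀ x {φ} → IsΣ φ → IsΣ (∃ᶠ x φ)

data IsPureEx : Formula → Set where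
  eq    : ∀ s t → IsPureEx (s ≐ t)
  pre   : ∀ s t → IsPureEx (s ≼ t)
  neq   : ∀ s t → IsPureEx (¬ᶠ (s ≐ t))
  npre  : ∀ s t → IsPureEx (¬ᶠ (s ≼ t))
  and   : ∀ {φ ψ} → IsPureEx φ → IsPureEx ψ → IsPureEx (φ ∧ᶠ ψ)
  or    : ∀ {φ ψ} → IsPureEx φ → IsPureEx ψ → IsPureEx (φ ∨ᶠ ψ)
  bex   : ∀ x t {φ} → ¬ OccursIn x t → IsPureEx φ → IsPureEx (∃≼ x t φ)
  ex    : ∀ x {φ} → IsPureEx φ → IsPureEx (∃ᶠ x φ)

Assignment : Set
Assignment = Var → BitString

update : Assignment → Var → BitString → Assignment
update ρ x a y with Data.Nat._≟_ x y
... | Relation.Nullary.yes _ = a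
... | Relation.Nullary.no  _ = ρ y

⟦_⟧ₜ : Term → Assignment → BitString
⟦ var x ⟧ₜ ρ = ρ x
⟦ e ⟧ₜ ρ = []
⟦ c0 ⟧ₜ ρ = false ∷ []
⟦ c1 ⟧ₜ ρ = true ∷ []
⟦ s ∘ₜ t ⟧ₜ ρ = ⟦ s ⟧ₜ ρ ++ ⟦ t ⟧ₜ ρ

_⊨_ : Assignment → Formula → Set
ρ ⊨ (s ≐ t) = ⟦ s ⟧ₜ ρ ≡ ⟦ t ⟧ₜ ρ
ρ ⊨ (s ≼ t) = ⟦ s ⟧ₜ ρ ⊑ ⟦ t ⟧ₜ ρ
ρ ⊨ (¬ᶠ φ) = ¬ (ρ ⊨ φ)
ρ ⊨ (φ ∧ᶠ ψ) = (ρ ⊨ φ) × (ρ ⊨ ψ)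
ρ ⊨ (φ ∨ᶠ ψ) = (ρ ⊨ φ) ⊎ (ρ ⊨ ψ)
ρ ⊨ (φ ⇒ᶠ ψ) = (ρ ⊨ φ) → (ρ ⊨ ψ)
ρ ⊨ ∃ᶠ x φ = Σ BitString (λ a → update ρ x a ⊨ φ)
ρ ⊨ ∀ᶠ x φ = (a : BitString) → update ρ x a ⊨ φ

_≡𝔇_ : Formula → Formula → Set
φ ≡𝔇 ψ = (ρ : Assignment) → (ρ ⊨ φ) ⇔ (ρ ⊨ ψ)

data Quant : Set where
  qEx    : Var → Quant
  qBEx   : Var → Term → Quant
  qBAll  : Var → Term → Quant

applyQuants : List Quant → Formula → Formula
applyQuants [] φ = φ
applyQuants (qEx v ∷ qs) φ = ∃ᶠ v (applyQuants qs φ)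
applyQuants (qBEx v t ∷ qs) φ = ∃≼ v t (applyQuants qs φ)
applyQuants (qBAll v t ∷ qs) φ = ∀≼ v t (applyQuants qs φ)

existsAll : List Var → Formula → Formula
existsAll [] φ = φ
existsAll (v ∷ vs) φ = ∃ᶠ v (existsAll vs φ)

-- A Σ-formula is first made positive: s ⪯ t becomes ∃z. s z = t, while ¬ s ⪯ t and s ≠ t
-- become existential disjunctions describing where s and t part ways. The quantifiers of a
-- positive formula are then pulled to the front, renaming bound variables apart; this also
-- works for a bounded (∀x ⪯ t) across a disjunction, because x ranges over the finitely many
-- prefixes of t. Finally the matrix, built from equations by ∧ and ∨, collapses into one
-- equation: A = B ∧ C = D iff A𝟎CA𝟏C = B𝟎DB𝟏D, and A = B ∨ C = D iff a system of word
-- equations in six fresh existentially quantified strings is solvable.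

module Submission where

open import Defs
open import Data.Bool using (true; false)
open import Data.Empty using (⊥; ⊥-elim)
open import Data.Fin using (Fin; zero; suc; toℕ)
open import Data.List using (List; []; _∷_; _++_; [_]; length; lookup)
open import Data.List.Properties
  using (++-assoc; ++-identityʳ; ++-identityʳ-unique; ++-cancelˡ; ++-conicalˡ; ∷-injective; ∷-injectiveˡ; ∷-injectiveʳ; length-++)
open import Data.List.Relation.Unary.All as All using (All; []; _∷_; head)
open import Data.List.Relation.Unary.All.Properties using (++⁺; ++⁻ˡ; ++⁻ʳ; map⁺; map⁻)
open import Data.Nat using (ℕ; suc; pred; _+_; _<_; _≤_; _⊔_; _≟_; s≤s; z<s; s<s)
open import Data.Nat.Properties
  using (≤-refl; ≤-trans; <-≤-trans; <-trans; <⇒≤; <⇒≢; <-cmp; n<1+n; m<n⇒m<1+n; m≤n+m; m≤n⇒m≤n⊔o; m≤n⇒m≤o⊔n; +-suc; +-mono-<; +-monoˡ-<)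
open import Data.Product using (Σ; ∃-syntax; _×_; _,_; proj₁; proj₂; uncurry)
import Data.Product.Function.Dependent.Propositional as Dependent
open import Data.Product.Function.NonDependent.Propositional using (_×-⇔_)
open import Data.Sum as Sum using (_⊎_; inj₁; inj₂)
open import Data.Sum.Function.Propositional using (_⊎-⇔_)
open import Data.Unit using (⊤; tt)
open import Function.Base using (_∘_; id)
open import Function.Bundles using (_⇔_; mk⇔; Equivalence)
open import Function.Properties.Equivalence using () renaming (refl to ⇔-refl; sym to ⇔-sym; trans to ⇔-trans)
open import Function.Properties.Inverse using (↔⇒⇔)
open import Function.Related.Propositional using (equivalence; ≡⇒; module EquationalReasoning)
open import Function.Related.TypeIsomorphisms using (→-cong-⇔; ×-comm; ⊎-comm)
open import Relation.Binary using (tri<; tri≈; tri>)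
open import Relation.Binary.PropositionalEquality
  using (_≡_; _≢_; refl; sym; trans; cong; cong₂; subst; module ≡-Reasoning)
open import Relation.Nullary using (¬_; yes; no; contradiction)

open Equivalence using (to; from)

private
  variable
    X : Set
    x y : X
    A B : Set
    P Q : Var → Set
    ρ ρ′ : Assignment

≡⇒⇔ : A ≡ B → A ⇔ B
≡⇒⇔ = ≡⇒ {k = equivalence}

∃-⇔ : {F G : BitString → Set} → (∀ {a} → F a ⇔ G a) → Σ BitString F ⇔ Σ BitString G
∃-⇔ = Dependent.congˡ {k = equivalence}

Π-⇔ : {F G : BitString → Set} → (∀ {a} → F a ⇔ G a) → ((a : BitString) → F a) ⇔ ((a : BitString) → G a)
Π-⇔ F⇔G = mk⇔ (λ f a → to F⇔G (f a)) (λ g a → from F⇔G (g a))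

m+m≡n+n⇒m≡n : ∀ {m n} → m + m ≡ n + n → m ≡ n
m+m≡n+n⇒m≡n {m} {n} h with <-cmp m n
... | tri< m<n _ _ = contradiction h (<⇒≢ (+-mono-< m<n m<n))
... | tri≈ _ m≡n _ = m≡n
... | tri> _ _ n<m = contradiction (sym h) (<⇒≢ (+-mono-< n<m n<m))

++-cancel-length : ∀ (us vs : List X) {ws ws'} → length us ≡ length vs →
                   us ++ ws ≡ vs ++ ws' → us ≡ vs × ws ≡ ws'
++-cancel-length []       []       _  h = refl , h
++-cancel-length (u ∷ us) (v ∷ vs) |us|≡|vs| h
  with refl , h′ ← ∷-injective h
  with refl , ws≡ws′ ← ++-cancel-length us vs (cong pred |us|≡|vs|) h′ = refl , ws≡ws′

prefix-by-markers : ∀ (us vs : List X) {ws ws' zs zs'} → x ≢ y →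
                    us ++ x ∷ ws ≡ vs ++ x ∷ ws' → us ++ y ∷ zs ≡ vs ++ y ∷ zs' → us ≡ vs
prefix-by-markers []       []       x≢y _ _ = refl
prefix-by-markers []       (v ∷ vs) x≢y e₁ e₂ = contradiction (trans (∷-injectiveˡ e₁) (sym (∷-injectiveˡ e₂))) x≢y
prefix-by-markers (u ∷ us) []       x≢y e₁ e₂ = contradiction (trans (sym (∷-injectiveˡ e₁)) (∷-injectiveˡ e₂)) x≢y
prefix-by-markers (u ∷ us) (v ∷ vs) x≢y e₁ e₂ =
  cong₂ _∷_ (∷-injectiveˡ e₁) (prefix-by-markers us vs x≢y (∷-injectiveʳ e₁) (∷-injectiveʳ e₂))

marker-free : ∀ (vs : List X) {ws} → ¬ All (x ≢_) (vs ++ x ∷ ws)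
marker-free vs h = head (++⁻ʳ vs h) refl

prefix-by-last-marker : ∀ (us vs : List X) {ws ws'} → All (x ≢_) ws → All (x ≢_) ws' →
                        us ++ x ∷ ws ≡ vs ++ x ∷ ws' → us ≡ vs
prefix-by-last-marker []       []       _  _   _  = refl
prefix-by-last-marker []       (v ∷ vs) ws _   h = ⊥-elim (marker-free vs (subst (All _) (∷-injectiveʳ h) ws))
prefix-by-last-marker (u ∷ us) []       _  ws' h = ⊥-elim (marker-free us (subst (All _) (sym (∷-injectiveʳ h)) ws'))
prefix-by-last-marker (u ∷ us) (v ∷ vs) ws ws' h =
  cong₂ _∷_ (∷-injectiveˡ h) (prefix-by-last-marker us vs ws ws' (∷-injectiveʳ h))

snoc≡cons⇒All≡ : ∀ (ws : List X) → ws ++ [ x ] ≡ x ∷ ws → All (_≡ x) ws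
snoc≡cons⇒All≡ []       _  = []
snoc≡cons⇒All≡ (w ∷ ws) h with refl ← ∷-injectiveˡ h = refl ∷ snoc≡cons⇒All≡ ws (∷-injectiveʳ h)

Solves : List (BitString × BitString) → Set
Solves = All (uncurry _≡_)

pair-injective : ∀ A B C D → A ++ false ∷ C ++ A ++ true ∷ C ≡ B ++ false ∷ D ++ B ++ true ∷ D →
                 A ≡ B × C ≡ D
pair-injective A B C D h =
  A≡B , ∷-injectiveʳ (++-cancelˡ B _ _ (subst (λ U → U ++ false ∷ C ≡ B ++ false ∷ D) A≡B first-halves))
  where
  open ≡-Reasoning
  marker-invariant : ∀ U V {b c} → length (U ++ b ∷ V) ≡ length (U ++ c ∷ V)
  marker-invariant U V = trans (length-++ U) (sym (length-++ U))
  h-assoc : (A ++ false ∷ C) ++ A ++ true ∷ C ≡ (B ++ false ∷ D) ++ B ++ true ∷ D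
  h-assoc = trans (++-assoc A _ _) (trans h (sym (++-assoc B _ _)))
  equal-halves : length (A ++ false ∷ C) ≡ length (B ++ false ∷ D)
  equal-halves = m+m≡n+n⇒m≡n (begin
    length (A ++ false ∷ C) + length (A ++ false ∷ C) ≡⟨ cong (length (A ++ false ∷ C) +_) (marker-invariant A C) ⟩
    length (A ++ false ∷ C) + length (A ++ true ∷ C)  ≡⟨ length-++ (A ++ false ∷ C) ⟨
    length ((A ++ false ∷ C) ++ A ++ true ∷ C)        ≡⟨ cong length h-assoc ⟩
    length ((B ++ false ∷ D) ++ B ++ true ∷ D)        ≡⟨ length-++ (B ++ false ∷ D) ⟩
    length (B ++ false ∷ D) + length (B ++ true ∷ D)  ≡⟨ cong (length (B ++ false ∷ D) +_) (marker-invariant B D) ⟩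
    length (B ++ false ∷ D) + length (B ++ false ∷ D) ∎)
  halves : A ++ false ∷ C ≡ B ++ false ∷ D × A ++ true ∷ C ≡ B ++ true ∷ D
  halves = ++-cancel-length (A ++ false ∷ C) (B ++ false ∷ D) equal-halves h-assoc
  first-halves : A ++ false ∷ C ≡ B ++ false ∷ D
  first-halves = proj₁ halves
  A≡B : A ≡ B
  A≡B = prefix-by-markers A B (λ ()) first-halves (proj₂ halves)

-- For Z = ε the system is solvable in P and S whatever A and B are, while for Z = 𝟏 the
-- first two equations force P, S ∈ 𝟏* and then the third forces A = B.
guard : (Z A B P S : BitString) → List (BitString × BitString)
guard Z A B P S =
  (P ++ Z , Z ++ P) ∷ (S ++ Z , Z ++ S) ∷ (P ++ false ∷ A ++ [ false ] , false ∷ B ++ false ∷ S) ∷ []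

guard-ε : ∀ A B → ∃[ P ] ∃[ S ] Solves (guard [] A B P S)
guard-ε A B = false ∷ B ++ [ false ] , false ∷ A ++ [ false ] ,
  ++-identityʳ _ ∷ ++-identityʳ _ ∷ cong (false ∷_) (++-assoc B [ false ] _) ∷ []

guard-≡ : ∀ Z A → Solves (guard Z A A [] [])
guard-≡ Z A = sym (++-identityʳ Z) ∷ sym (++-identityʳ Z) ∷ refl ∷ []

guard-𝟏 : ∀ {A B P S} → Solves (guard [ true ] A B P S) → A ≡ B
guard-𝟏 {A} {B} {P} {S} (P𝟏≡𝟏P ∷ S𝟏≡𝟏S ∷ h ∷ []) with P | snoc≡cons⇒All≡ P P𝟏≡𝟏P
... | []    | _ = prefix-by-last-marker A B [] (All.map (λ { refl () }) (snoc≡cons⇒All≡ S S𝟏≡𝟏S)) (∷-injectiveʳ h)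
... | _ ∷ _ | refl ∷ _ with () ← ∷-injectiveˡ h

-- Z W = 𝟏 makes one of Z, W equal to 𝟏 and the other ε.
orSystem : (A B C D Z W P S P′ S′ : BitString) → List (BitString × BitString)
orSystem A B C D Z W P S P′ S′ = (Z ++ W , [ true ]) ∷ guard Z A B P S ++ guard W C D P′ S′

or-encoding : ∀ A B C D →
  (A ≡ B ⊎ C ≡ D) ⇔ (∃[ Z ] ∃[ W ] ∃[ P ] ∃[ S ] ∃[ P′ ] ∃[ S′ ] Solves (orSystem A B C D Z W P S P′ S′))
or-encoding A B C D = mk⇔ encode decode
  where
  encode : A ≡ B ⊎ C ≡ D → ∃[ Z ] ∃[ W ] ∃[ P ] ∃[ S ] ∃[ P′ ] ∃[ S′ ] Solves (orSystem A B C D Z W P S P′ S′)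
  encode (inj₁ refl) with P′ , S′ , solved ← guard-ε C D =
    [ true ] , [] , [] , [] , P′ , S′ , refl ∷ ++⁺ (guard-≡ [ true ] A) solved
  encode (inj₂ refl) with P , S , solved ← guard-ε A B =
    [] , [ true ] , P , S , [] , [] , refl ∷ ++⁺ solved (guard-≡ [ true ] C)
  decode : ∃[ Z ] ∃[ W ] ∃[ P ] ∃[ S ] ∃[ P′ ] ∃[ S′ ] Solves (orSystem A B C D Z W P S P′ S′) → A ≡ B ⊎ C ≡ D
  decode ([]            , _  , P , S , _ , _ , refl ∷ gs) = inj₂ (guard-𝟏 (++⁻ʳ (guard [] A B P S) gs))
  decode (true ∷ []     , [] , P , S , _ , _ , refl ∷ gs) = inj₁ (guard-𝟏 (++⁻ˡ (guard [ true ] A B P S) gs))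
  decode (true ∷ []     , _ ∷ _ , _ , _ , _ , _ , () ∷ _)
  decode (true ∷ _ ∷ _  , _  , _ , _ , _ , _ , () ∷ _)
  decode (false ∷ _     , _  , _ , _ , _ , _ , () ∷ _)

⊑-refl : ∀ S → S ⊑ S
⊑-refl S = [] , ++-identityʳ S

⊑-antisym : ∀ {S T} → S ⊑ T → T ⊑ S → S ≡ T
⊑-antisym {S} (U , refl) (V , h) with refl ← ++-conicalˡ U V (++-identityʳ-unique S (trans (sym h) (++-assoc S U V))) =
  sym (++-identityʳ S)

NotPrefixVia : (S T P Q R : BitString) → Set
NotPrefixVia S T P Q R =
  (S ≡ P ++ false ∷ Q × T ≡ P ++ true ∷ R) ⊎ (S ≡ P ++ true ∷ Q × T ≡ P ++ false ∷ R) ⊎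
  S ≡ T ++ false ∷ Q ⊎ S ≡ T ++ true ∷ Q

NotPrefix : BitString → BitString → Set
NotPrefix S T = ∃[ P ] ∃[ Q ] ∃[ R ] NotPrefixVia S T P Q R

NotPrefix-∷ : ∀ b {S T} → NotPrefix S T → NotPrefix (b ∷ S) (b ∷ T)
NotPrefix-∷ b (P , Q , R , inj₁ (refl , refl))               = b ∷ P , Q , R , inj₁ (refl , refl)
NotPrefix-∷ b (P , Q , R , inj₂ (inj₁ (refl , refl)))        = b ∷ P , Q , R , inj₂ (inj₁ (refl , refl))
NotPrefix-∷ b (P , Q , R , inj₂ (inj₂ (inj₁ refl)))          = P , Q , R , inj₂ (inj₂ (inj₁ refl))
NotPrefix-∷ b (P , Q , R , inj₂ (inj₂ (inj₂ refl)))          = P , Q , R , inj₂ (inj₂ (inj₂ refl))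

⊑-or-NotPrefix : ∀ S T → S ⊑ T ⊎ NotPrefix S T
⊑-or-NotPrefix []          T           = inj₁ (T , refl)
⊑-or-NotPrefix (false ∷ S) []          = inj₂ ([] , S , [] , inj₂ (inj₂ (inj₁ refl)))
⊑-or-NotPrefix (true ∷ S)  []          = inj₂ ([] , S , [] , inj₂ (inj₂ (inj₂ refl)))
⊑-or-NotPrefix (false ∷ S) (true ∷ T)  = inj₂ ([] , S , T , inj₁ (refl , refl))
⊑-or-NotPrefix (true ∷ S)  (false ∷ T) = inj₂ ([] , S , T , inj₂ (inj₁ (refl , refl)))
⊑-or-NotPrefix (false ∷ S) (false ∷ T) = Sum.map (λ (U , h) → U , cong (false ∷_) h) (NotPrefix-∷ false) (⊑-or-NotPrefix S T)
⊑-or-NotPrefix (true ∷ S)  (true ∷ T)  = Sum.map (λ (U , h) → U , cong (true ∷_) h) (NotPrefix-∷ true) (⊑-or-NotPrefix S T)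

NotPrefix⇒⋢ : ∀ {S T} → NotPrefix S T → ¬ S ⊑ T
NotPrefix⇒⋢ (P , Q , R , inj₁ (refl , refl)) (U , h)
  with () ← ∷-injectiveˡ (++-cancelˡ P _ _ (trans (sym (++-assoc P (false ∷ Q) U)) h))
NotPrefix⇒⋢ (P , Q , R , inj₂ (inj₁ (refl , refl))) (U , h)
  with () ← ∷-injectiveˡ (++-cancelˡ P _ _ (trans (sym (++-assoc P (true ∷ Q) U)) h))
NotPrefix⇒⋢ {T = T} (P , Q , R , inj₂ (inj₂ (inj₁ refl))) (U , h)
  with () ← ++-identityʳ-unique T (sym (trans (sym (++-assoc T (false ∷ Q) U)) h))
NotPrefix⇒⋢ {T = T} (P , Q , R , inj₂ (inj₂ (inj₂ refl))) (U , h)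
  with () ← ++-identityʳ-unique T (sym (trans (sym (++-assoc T (true ∷ Q) U)) h))

⋢⇔NotPrefix : ∀ S T → (¬ S ⊑ T) ⇔ NotPrefix S T
⋢⇔NotPrefix S T = mk⇔ from-⋢ NotPrefix⇒⋢
  where
  from-⋢ : ¬ S ⊑ T → NotPrefix S T
  from-⋢ S⋢T with ⊑-or-NotPrefix S T
  ... | inj₁ S⊑T = contradiction S⊑T S⋢T
  ... | inj₂ np  = np

≢⇔⋢⊎⋣ : ∀ S T → (S ≢ T) ⇔ (¬ S ⊑ T ⊎ ¬ T ⊑ S)
≢⇔⋢⊎⋣ S T = mk⇔ from-≢ to-≢
  where
  from-≢ : S ≢ T → ¬ S ⊑ T ⊎ ¬ T ⊑ S
  from-≢ S≢T with ⊑-or-NotPrefix S T | ⊑-or-NotPrefix T S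
  ... | inj₂ np  | _        = inj₁ (NotPrefix⇒⋢ np)
  ... | inj₁ _   | inj₂ np  = inj₂ (NotPrefix⇒⋢ np)
  ... | inj₁ S⊑T | inj₁ T⊑S = contradiction (⊑-antisym S⊑T T⊑S) S≢T
  to-≢ : ¬ S ⊑ T ⊎ ¬ T ⊑ S → S ≢ T
  to-≢ (inj₁ S⋢T) refl = S⋢T (⊑-refl S)
  to-≢ (inj₂ T⋢S) refl = T⋢S (⊑-refl S)

-- Constructively valid because U ranges over the finitely many prefixes of T.
∀⊑-distribʳ-⊎ : ∀ T {P : BitString → Set} {B : Set} →
                (∀ U → U ⊑ T → P U ⊎ B) → (∀ U → U ⊑ T → P U) ⊎ B
∀⊑-distribʳ-⊎ [] f with f [] ([] , refl)
... | inj₂ b = inj₂ b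
... | inj₁ p = inj₁ λ { [] _ → p ; (_ ∷ _) (_ , ()) }
∀⊑-distribʳ-⊎ (c ∷ T) {P} {B} f
  with f [] (c ∷ T , refl) | ∀⊑-distribʳ-⊎ T {λ U → P (c ∷ U)} (λ U (V , h) → f (c ∷ U) (V , cong (c ∷_) h))
... | inj₂ b | _      = inj₂ b
... | inj₁ _ | inj₂ b = inj₂ b
... | inj₁ p | inj₁ g = inj₁ extend
  where
  extend : ∀ U → U ⊑ (c ∷ T) → P U
  extend []      _       = p
  extend (_ ∷ U) (V , h) with refl , h′ ← ∷-injective h = g U (V , h′)

update-≡ : ∀ ρ x a → update ρ x a x ≡ a
update-≡ ρ x a with x ≟ x
... | yes _  = refl
... | no x≢x = contradiction refl x≢x

update-≢ : ∀ ρ {x y} a → x ≢ y → update ρ x a y ≡ ρ y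
update-≢ ρ {x} {y} a x≢y with x ≟ y
... | yes x≡y = contradiction x≡y x≢y
... | no _    = refl

update-< : ∀ ρ {x y} a → y < x → update ρ x a y ≡ ρ y
update-< ρ a y<x = update-≢ ρ a (λ x≡y → <⇒≢ y<x (sym x≡y))

AllVarsₜ : (Var → Set) → Term → Set
AllVarsₜ P (var x)  = P x
AllVarsₜ P e        = ⊤
AllVarsₜ P c0       = ⊤
AllVarsₜ P c1       = ⊤
AllVarsₜ P (s ∘ₜ t) = AllVarsₜ P s × AllVarsₜ P t

-- Only variables occurring inside terms are constrained, not binders: this is all that
-- the semantics of a formula depends on.
AllVars : (Var → Set) → Formula → Set
AllVars P (s ≐ t)  = AllVarsₜ P s × AllVarsₜ P t
AllVars P (s ≼ t)  = AllVarsₜ P s × AllVarsₜ P t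
AllVars P (¬ᶠ φ)   = AllVars P φ
AllVars P (φ ∧ᶠ ψ) = AllVars P φ × AllVars P ψ
AllVars P (φ ∨ᶠ ψ) = AllVars P φ × AllVars P ψ
AllVars P (φ ⇒ᶠ ψ) = AllVars P φ × AllVars P ψ
AllVars P (∃ᶠ x φ) = AllVars P φ
AllVars P (∀ᶠ x φ) = AllVars P φ

AllVarsₜ-mono : (∀ {y} → P y → Q y) → ∀ t → AllVarsₜ P t → AllVarsₜ Q t
AllVarsₜ-mono P⊆Q (var x)  p        = P⊆Q p
AllVarsₜ-mono P⊆Q e        _        = tt
AllVarsₜ-mono P⊆Q c0       _        = tt
AllVarsₜ-mono P⊆Q c1       _        = tt
AllVarsₜ-mono P⊆Q (s ∘ₜ t) (ps , pt) = AllVarsₜ-mono P⊆Q s ps , AllVarsₜ-mono P⊆Q t pt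

AllVars-mono : (∀ {y} → P y → Q y) → ∀ φ → AllVars P φ → AllVars Q φ
AllVars-mono P⊆Q (s ≐ t)  (ps , pt) = AllVarsₜ-mono P⊆Q s ps , AllVarsₜ-mono P⊆Q t pt
AllVars-mono P⊆Q (s ≼ t)  (ps , pt) = AllVarsₜ-mono P⊆Q s ps , AllVarsₜ-mono P⊆Q t pt
AllVars-mono P⊆Q (¬ᶠ φ)   p         = AllVars-mono P⊆Q φ p
AllVars-mono P⊆Q (φ ∧ᶠ ψ) (p , q)   = AllVars-mono P⊆Q φ p , AllVars-mono P⊆Q ψ q
AllVars-mono P⊆Q (φ ∨ᶠ ψ) (p , q)   = AllVars-mono P⊆Q φ p , AllVars-mono P⊆Q ψ q
AllVars-mono P⊆Q (φ ⇒ᶠ ψ) (p , q)   = AllVars-mono P⊆Q φ p , AllVars-mono P⊆Q ψ q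
AllVars-mono P⊆Q (∃ᶠ x φ) p         = AllVars-mono P⊆Q φ p
AllVars-mono P⊆Q (∀ᶠ x φ) p         = AllVars-mono P⊆Q φ p

maxVarₜ : Term → ℕ
maxVarₜ (var x)  = x
maxVarₜ e        = 0
maxVarₜ c0       = 0
maxVarₜ c1       = 0
maxVarₜ (s ∘ₜ t) = maxVarₜ s ⊔ maxVarₜ t

AllVarsₜ-≤maxVarₜ : ∀ t → AllVarsₜ (_≤ maxVarₜ t) t
AllVarsₜ-≤maxVarₜ (var x)  = ≤-refl
AllVarsₜ-≤maxVarₜ e        = _
AllVarsₜ-≤maxVarₜ c0       = _
AllVarsₜ-≤maxVarₜ c1       = _
AllVarsₜ-≤maxVarₜ (s ∘ₜ t) = AllVarsₜ-mono (m≤n⇒m≤n⊔o (maxVarₜ t)) s (AllVarsₜ-≤maxVarₜ s) ,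
  AllVarsₜ-mono (m≤n⇒m≤o⊔n (maxVarₜ s)) t (AllVarsₜ-≤maxVarₜ t)

maxVar : Formula → ℕ
maxVar (s ≐ t)  = maxVarₜ s ⊔ maxVarₜ t
maxVar (s ≼ t)  = maxVarₜ s ⊔ maxVarₜ t
maxVar (¬ᶠ φ)   = maxVar φ
maxVar (φ ∧ᶠ ψ) = maxVar φ ⊔ maxVar ψ
maxVar (φ ∨ᶠ ψ) = maxVar φ ⊔ maxVar ψ
maxVar (φ ⇒ᶠ ψ) = maxVar φ ⊔ maxVar ψ
maxVar (∃ᶠ x φ) = maxVar φ
maxVar (∀ᶠ x φ) = maxVar φ

AllVars-≤maxVar : ∀ φ → AllVars (_≤ maxVar φ) φ
AllVars-≤maxVar (s ≐ t)  = AllVarsₜ-mono (m≤n⇒m≤n⊔o (maxVarₜ t)) s (AllVarsₜ-≤maxVarₜ s) ,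
  AllVarsₜ-mono (m≤n⇒m≤o⊔n (maxVarₜ s)) t (AllVarsₜ-≤maxVarₜ t)
AllVars-≤maxVar (s ≼ t)  = AllVarsₜ-mono (m≤n⇒m≤n⊔o (maxVarₜ t)) s (AllVarsₜ-≤maxVarₜ s) ,
  AllVarsₜ-mono (m≤n⇒m≤o⊔n (maxVarₜ s)) t (AllVarsₜ-≤maxVarₜ t)
AllVars-≤maxVar (¬ᶠ φ)   = AllVars-≤maxVar φ
AllVars-≤maxVar (φ ∧ᶠ ψ) = AllVars-mono (m≤n⇒m≤n⊔o (maxVar ψ)) φ (AllVars-≤maxVar φ) ,
  AllVars-mono (m≤n⇒m≤o⊔n (maxVar φ)) ψ (AllVars-≤maxVar ψ)
AllVars-≤maxVar (φ ∨ᶠ ψ) = AllVars-mono (m≤n⇒m≤n⊔o (maxVar ψ)) φ (AllVars-≤maxVar φ) ,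
  AllVars-mono (m≤n⇒m≤o⊔n (maxVar φ)) ψ (AllVars-≤maxVar ψ)
AllVars-≤maxVar (φ ⇒ᶠ ψ) = AllVars-mono (m≤n⇒m≤n⊔o (maxVar ψ)) φ (AllVars-≤maxVar φ) ,
  AllVars-mono (m≤n⇒m≤o⊔n (maxVar φ)) ψ (AllVars-≤maxVar ψ)
AllVars-≤maxVar (∃ᶠ x φ) = AllVars-≤maxVar φ
AllVars-≤maxVar (∀ᶠ x φ) = AllVars-≤maxVar φ

fresh : Term → Term → Var
fresh s t = suc (maxVarₜ s ⊔ maxVarₜ t)

below-freshˡ : ∀ s t → AllVarsₜ (_< fresh s t) s
below-freshˡ s t = AllVarsₜ-mono (λ y≤ → s≤s (m≤n⇒m≤n⊔o (maxVarₜ t) y≤)) s (AllVarsₜ-≤maxVarₜ s)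

below-freshʳ : ∀ s t → AllVarsₜ (_< fresh s t) t
below-freshʳ s t = AllVarsₜ-mono (λ y≤ → s≤s (m≤n⇒m≤o⊔n (maxVarₜ s) y≤)) t (AllVarsₜ-≤maxVarₜ t)

¬OccursIn⇒AllVarsₜ : ∀ {x} t → ¬ OccursIn x t → AllVarsₜ (x ≢_) t
¬OccursIn⇒AllVarsₜ (var y)  x∉t = λ { refl → x∉t here }
¬OccursIn⇒AllVarsₜ e        _   = tt
¬OccursIn⇒AllVarsₜ c0       _   = tt
¬OccursIn⇒AllVarsₜ c1       _   = tt
¬OccursIn⇒AllVarsₜ (s ∘ₜ t) x∉t = ¬OccursIn⇒AllVarsₜ s (x∉t ∘ left) , ¬OccursIn⇒AllVarsₜ t (x∉t ∘ right)

Agree : (Var → Set) → Assignment → Assignment → Set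
Agree P ρ ρ′ = ∀ {y} → P y → ρ y ≡ ρ′ y

Agree-update : ∀ x a → Agree P ρ ρ′ → Agree P (update ρ x a) (update ρ′ x a)
Agree-update x a ρ≈ρ′ {y} py with x ≟ y
... | yes _ = refl
... | no _  = ρ≈ρ′ py

⟦⟧ₜ-coincidence : ∀ t → AllVarsₜ P t → Agree P ρ ρ′ → ⟦ t ⟧ₜ ρ ≡ ⟦ t ⟧ₜ ρ′
⟦⟧ₜ-coincidence (var x)  px        ρ≈ρ′ = ρ≈ρ′ px
⟦⟧ₜ-coincidence e        _         _    = refl
⟦⟧ₜ-coincidence c0       _         _    = refl
⟦⟧ₜ-coincidence c1       _         _    = refl
⟦⟧ₜ-coincidence (s ∘ₜ t) (ps , pt) ρ≈ρ′ = cong₂ _++_ (⟦⟧ₜ-coincidence s ps ρ≈ρ′) (⟦⟧ₜ-coincidence t pt ρ≈ρ′)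

⊨-coincidence : ∀ φ → AllVars P φ → Agree P ρ ρ′ → (ρ ⊨ φ) ⇔ (ρ′ ⊨ φ)
⊨-coincidence (s ≐ t)  (ps , pt) ρ≈ρ′ = ≡⇒⇔ (cong₂ _≡_ (⟦⟧ₜ-coincidence s ps ρ≈ρ′) (⟦⟧ₜ-coincidence t pt ρ≈ρ′))
⊨-coincidence (s ≼ t)  (ps , pt) ρ≈ρ′ = ≡⇒⇔ (cong₂ _⊑_ (⟦⟧ₜ-coincidence s ps ρ≈ρ′) (⟦⟧ₜ-coincidence t pt ρ≈ρ′))
⊨-coincidence (¬ᶠ φ)   p         ρ≈ρ′ = →-cong-⇔ (⊨-coincidence φ p ρ≈ρ′) ⇔-refl
⊨-coincidence (φ ∧ᶠ ψ) (p , q)   ρ≈ρ′ = ⊨-coincidence φ p ρ≈ρ′ ×-⇔ ⊨-coincidence ψ q ρ≈ρ′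
⊨-coincidence (φ ∨ᶠ ψ) (p , q)   ρ≈ρ′ = ⊨-coincidence φ p ρ≈ρ′ ⊎-⇔ ⊨-coincidence ψ q ρ≈ρ′
⊨-coincidence (φ ⇒ᶠ ψ) (p , q)   ρ≈ρ′ = →-cong-⇔ (⊨-coincidence φ p ρ≈ρ′) (⊨-coincidence ψ q ρ≈ρ′)
⊨-coincidence (∃ᶠ x φ) p         ρ≈ρ′ = ∃-⇔ (⊨-coincidence φ p (Agree-update x _ ρ≈ρ′))
⊨-coincidence (∀ᶠ x φ) p         ρ≈ρ′ = Π-⇔ (⊨-coincidence φ p (Agree-update x _ ρ≈ρ′))

_#ₜ_ : Var → Term → Set
x #ₜ t = AllVarsₜ (x ≢_) t

_#_ : Var → Formula → Set
x # φ = AllVars (x ≢_) φ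

⟦⟧ₜ-update-# : ∀ {x} t a → x #ₜ t → ⟦ t ⟧ₜ (update ρ x a) ≡ ⟦ t ⟧ₜ ρ
⟦⟧ₜ-update-# {ρ} t a x#t = ⟦⟧ₜ-coincidence t x#t (update-≢ ρ a)

Indep : Var → Formula → Set
Indep x φ = ∀ ρ a → (update ρ x a ⊨ φ) ⇔ (ρ ⊨ φ)

#⇒Indep : ∀ {x} φ → x # φ → Indep x φ
#⇒Indep φ x#φ ρ a = ⊨-coincidence φ x#φ (update-≢ ρ a)

<⇒#ₜ : ∀ {k v} t → k ≤ v → AllVarsₜ (_< k) t → v #ₜ t
<⇒#ₜ t k≤v = AllVarsₜ-mono (λ y<k v≡y → <⇒≢ (<-≤-trans y<k k≤v) (sym v≡y)) t

renameₜ : (Var → Var) → Term → Term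
renameₜ σ (var x)  = var (σ x)
renameₜ σ e        = e
renameₜ σ c0       = c0
renameₜ σ c1       = c1
renameₜ σ (s ∘ₜ t) = renameₜ σ s ∘ₜ renameₜ σ t

⟦renameₜ⟧ : ∀ σ t → ⟦ renameₜ σ t ⟧ₜ ρ ≡ ⟦ t ⟧ₜ (ρ ∘ σ)
⟦renameₜ⟧ σ (var x)  = refl
⟦renameₜ⟧ σ e        = refl
⟦renameₜ⟧ σ c0       = refl
⟦renameₜ⟧ σ c1       = refl
⟦renameₜ⟧ σ (s ∘ₜ t) = cong₂ _++_ (⟦renameₜ⟧ σ s) (⟦renameₜ⟧ σ t)

AllVarsₜ-renameₜ : ∀ σ t → AllVarsₜ (P ∘ σ) t → AllVarsₜ P (renameₜ σ t)
AllVarsₜ-renameₜ σ (var x)  p         = p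
AllVarsₜ-renameₜ σ e        _         = tt
AllVarsₜ-renameₜ σ c0       _         = tt
AllVarsₜ-renameₜ σ c1       _         = tt
AllVarsₜ-renameₜ σ (s ∘ₜ t) (ps , pt) = AllVarsₜ-renameₜ σ s ps , AllVarsₜ-renameₜ σ t pt

-- The assignment reached inside ∃k ∃(k+1) … ∃(k+n-1) when the witnesses are as.
updates : Assignment → Var → List BitString → Assignment
updates ρ k []       = ρ
updates ρ k (a ∷ as) = updates (update ρ k a) (suc k) as

updates-< : ∀ ρ {k y} as → y < k → updates ρ k as y ≡ ρ y
updates-< ρ         []       y<k = refl
updates-< ρ {k} {y} (a ∷ as) y<k = trans (updates-< (update ρ k a) as (<-trans y<k (n<1+n k))) (update-< ρ a y<k)

updates-lookup : ∀ ρ k as (i : Fin (length as)) → updates ρ k as (toℕ i + k) ≡ lookup as i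
updates-lookup ρ k (a ∷ as) zero    = trans (updates-< (update ρ k a) as (n<1+n k)) (update-≡ ρ k a)
updates-lookup ρ k (a ∷ as) (suc i) =
  trans (cong (updates (update ρ k a) (suc k) as) (sym (+-suc (toℕ i) k))) (updates-lookup (update ρ k a) (suc k) as i)

update-ε-⊑ : ∀ ρ x T → update ρ x [] x ⊑ T
update-ε-⊑ ρ x T = subst (_⊑ T) (sym (update-≡ ρ x [])) (T , refl)

binder : Quant → Var
binder (qEx v)     = v
binder (qBEx v t)  = v
binder (qBAll v t) = v

-- The range of v in (∀v ≼ t) must not depend on v.
NonCircular : Quant → Set
NonCircular (qBAll v t) = v #ₜ t
NonCircular _           = ⊤

exists-from : Var → ℕ → List Quant
exists-from k 0       = []
exists-from k (suc n) = qEx k ∷ exists-from (suc k) n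

exists-from-All : ∀ {Q : Quant → Set} k c → (∀ {v} → k ≤ v → Q (qEx v)) → All Q (exists-from k c)
exists-from-All k 0       _  = []
exists-from-All k (suc c) Qk = Qk ≤-refl ∷ exists-from-All (suc k) c (λ k<v → Qk (<⇒≤ k<v))

applyQuants-++ : ∀ qs qs′ φ → applyQuants (qs ++ qs′) φ ≡ applyQuants qs (applyQuants qs′ φ)
applyQuants-++ []               qs′ φ = refl
applyQuants-++ (qEx v ∷ qs)     qs′ φ = cong (∃ᶠ v) (applyQuants-++ qs qs′ φ)
applyQuants-++ (qBEx v t ∷ qs)  qs′ φ = cong (∃≼ v t) (applyQuants-++ qs qs′ φ)
applyQuants-++ (qBAll v t ∷ qs) qs′ φ = cong (∀≼ v t) (applyQuants-++ qs qs′ φ)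

applyQuants-cong : ∀ qs {φ ψ} → φ ≡𝔇 ψ → applyQuants qs φ ≡𝔇 applyQuants qs ψ
applyQuants-cong []               φ≡ψ ρ = φ≡ψ ρ
applyQuants-cong (qEx v ∷ qs)     φ≡ψ ρ = ∃-⇔ (applyQuants-cong qs φ≡ψ _)
applyQuants-cong (qBEx v t ∷ qs)  φ≡ψ ρ = ∃-⇔ (⇔-refl ×-⇔ applyQuants-cong qs φ≡ψ _)
applyQuants-cong (qBAll v t ∷ qs) φ≡ψ ρ = Π-⇔ (→-cong-⇔ ⇔-refl (applyQuants-cong qs φ≡ψ _))

∧-pullʳ : ∀ qs {E B} → All (λ q → Indep (binder q) B) qs → (applyQuants qs E ∧ᶠ B) ≡𝔇 applyQuants qs (E ∧ᶠ B)
∧-pullʳ []                   _           ρ = ⇔-refl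
∧-pullʳ (qEx v ∷ qs) (ind ∷ inds) ρ = mk⇔
  (λ ((a , p) , b) → a , to (∧-pullʳ qs inds _) (p , from (ind ρ a) b))
  (λ (a , pb) → let p , b = from (∧-pullʳ qs inds _) pb in (a , p) , to (ind ρ a) b)
∧-pullʳ (qBEx v t ∷ qs) (ind ∷ inds) ρ = mk⇔
  (λ ((a , a≼t , p) , b) → a , a≼t , to (∧-pullʳ qs inds _) (p , from (ind ρ a) b))
  (λ (a , a≼t , pb) → let p , b = from (∧-pullʳ qs inds _) pb in (a , a≼t , p) , to (ind ρ a) b)
∧-pullʳ (qBAll v t ∷ qs) (ind ∷ inds) ρ = mk⇔
  (λ (f , b) a a≼t → to (∧-pullʳ qs inds _) (f a a≼t , from (ind ρ a) b))
  (λ g → (λ a a≼t → proj₁ (from (∧-pullʳ qs inds _) (g a a≼t))) ,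
         to (ind ρ []) (proj₂ (from (∧-pullʳ qs inds _) (g [] (update-ε-⊑ ρ v _)))))

∨-pullʳ : ∀ qs {E B} → All (λ q → Indep (binder q) B) qs → All NonCircular qs →
          (applyQuants qs E ∨ᶠ B) ≡𝔇 applyQuants qs (E ∨ᶠ B)
∨-pullʳ []                   _          _        ρ = ⇔-refl
∨-pullʳ (qEx v ∷ qs) (ind ∷ inds) (_ ∷ nc) ρ = mk⇔
  Sum.[ (λ (a , p) → a , to (∨-pullʳ qs inds nc _) (inj₁ p))
  , (λ b → [] , to (∨-pullʳ qs inds nc _) (inj₂ (from (ind ρ []) b))) ]
  (λ (a , pb) → Sum.map (a ,_) (to (ind ρ a)) (from (∨-pullʳ qs inds nc _) pb))
∨-pullʳ (qBEx v t ∷ qs) (ind ∷ inds) (_ ∷ nc) ρ = mk⇔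
  Sum.[ (λ (a , a≼t , p) → a , a≼t , to (∨-pullʳ qs inds nc _) (inj₁ p))
  , (λ b → [] , update-ε-⊑ ρ v _ , to (∨-pullʳ qs inds nc _) (inj₂ (from (ind ρ []) b))) ]
  (λ (a , a≼t , pb) → Sum.map (λ p → a , a≼t , p) (to (ind ρ a)) (from (∨-pullʳ qs inds nc _) pb))
∨-pullʳ (qBAll v t ∷ qs) (ind ∷ inds) (v#t ∷ nc) ρ = mk⇔
  Sum.[ (λ f a a≼t → to (∨-pullʳ qs inds nc _) (inj₁ (f a a≼t)))
  , (λ b a _ → to (∨-pullʳ qs inds nc _) (inj₂ (from (ind ρ a) b))) ]
  (λ g → Sum.map (λ f a a≼t → f a (to bound a≼t)) id
           (∀⊑-distribʳ-⊎ (⟦ t ⟧ₜ ρ)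
             (λ a a⊑t → Sum.map id (to (ind ρ a)) (from (∨-pullʳ qs inds nc _) (g a (from bound a⊑t))))))
  where
  bound : ∀ {a} → (update ρ v a v ⊑ ⟦ t ⟧ₜ (update ρ v a)) ⇔ (a ⊑ ⟦ t ⟧ₜ ρ)
  bound {a} = ≡⇒⇔ (cong₂ _⊑_ (update-≡ ρ v a) (⟦⟧ₜ-update-# t a v#t))

∧-pullˡ : ∀ qs {E B} → All (λ q → Indep (binder q) B) qs → (B ∧ᶠ applyQuants qs E) ≡𝔇 applyQuants qs (B ∧ᶠ E)
∧-pullˡ qs inds ρ =
  ⇔-trans (↔⇒⇔ (×-comm _ _)) (⇔-trans (∧-pullʳ qs inds ρ) (applyQuants-cong qs (λ _ → ↔⇒⇔ (×-comm _ _)) ρ))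

∨-pullˡ : ∀ qs {E B} → All (λ q → Indep (binder q) B) qs → All NonCircular qs →
          (B ∨ᶠ applyQuants qs E) ≡𝔇 applyQuants qs (B ∨ᶠ E)
∨-pullˡ qs inds nc ρ =
  ⇔-trans (↔⇒⇔ (⊎-comm _ _)) (⇔-trans (∨-pullʳ qs inds nc ρ) (applyQuants-cong qs (λ _ → ↔⇒⇔ (⊎-comm _ _)) ρ))

∧-prenex : ∀ qs₁ qs₂ {E₁ E₂} →
           All (λ q → Indep (binder q) (applyQuants qs₂ E₂)) qs₁ → All (λ q → Indep (binder q) E₁) qs₂ →
           (applyQuants qs₁ E₁ ∧ᶠ applyQuants qs₂ E₂) ≡𝔇 applyQuants (qs₁ ++ qs₂) (E₁ ∧ᶠ E₂)
∧-prenex qs₁ qs₂ {E₁} {E₂} inds₁ inds₂ ρ = begin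
  ρ ⊨ (applyQuants qs₁ E₁ ∧ᶠ applyQuants qs₂ E₂) ∼⟨ ∧-pullʳ qs₁ inds₁ ρ ⟩
  ρ ⊨ applyQuants qs₁ (E₁ ∧ᶠ applyQuants qs₂ E₂) ∼⟨ applyQuants-cong qs₁ (∧-pullˡ qs₂ inds₂) ρ ⟩
  ρ ⊨ applyQuants qs₁ (applyQuants qs₂ (E₁ ∧ᶠ E₂)) ≡⟨ cong (ρ ⊨_) (applyQuants-++ qs₁ qs₂ _) ⟨
  ρ ⊨ applyQuants (qs₁ ++ qs₂) (E₁ ∧ᶠ E₂) ∎
  where open EquationalReasoning

∨-prenex : ∀ qs₁ qs₂ {E₁ E₂} →
           All (λ q → Indep (binder q) (applyQuants qs₂ E₂)) qs₁ → All (λ q → Indep (binder q) E₁) qs₂ →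
           All NonCircular qs₁ → All NonCircular qs₂ →
           (applyQuants qs₁ E₁ ∨ᶠ applyQuants qs₂ E₂) ≡𝔇 applyQuants (qs₁ ++ qs₂) (E₁ ∨ᶠ E₂)
∨-prenex qs₁ qs₂ {E₁} {E₂} inds₁ inds₂ nc₁ nc₂ ρ = begin
  ρ ⊨ (applyQuants qs₁ E₁ ∨ᶠ applyQuants qs₂ E₂) ∼⟨ ∨-pullʳ qs₁ inds₁ nc₁ ρ ⟩
  ρ ⊨ applyQuants qs₁ (E₁ ∨ᶠ applyQuants qs₂ E₂) ∼⟨ applyQuants-cong qs₁ (∨-pullˡ qs₂ inds₂ nc₂) ρ ⟩
  ρ ⊨ applyQuants qs₁ (applyQuants qs₂ (E₁ ∨ᶠ E₂)) ≡⟨ cong (ρ ⊨_) (applyQuants-++ qs₁ qs₂ _) ⟨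
  ρ ⊨ applyQuants (qs₁ ++ qs₂) (E₁ ∨ᶠ E₂) ∎
  where open EquationalReasoning

-- Equations encoding conjunctions, disjunctions and prefix atoms

pairₜ : Term → Term → Term
pairₜ a c = a ∘ₜ (c0 ∘ₜ (c ∘ₜ (a ∘ₜ (c1 ∘ₜ c))))

pairₜ-vars : ∀ {P : Var → Set} a c → AllVarsₜ P a → AllVarsₜ P c → AllVarsₜ P (pairₜ a c)
pairₜ-vars a c pa pc = pa , _ , pc , pa , _ , pc

pairₜ-⊨ : ∀ a b c d → (ρ ⊨ (pairₜ a c ≐ pairₜ b d)) ⇔ ((ρ ⊨ (a ≐ b)) × (ρ ⊨ (c ≐ d)))
pairₜ-⊨ a b c d = mk⇔ (pair-injective _ _ _ _) (λ (a≡b , c≡d) → cong₂ (λ A C → A ++ false ∷ C ++ A ++ true ∷ C) a≡b c≡d)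

equation : Term × Term → Formula
equation (s , t) = s ≐ t

conjoin : List (Term × Term) → Term × Term
conjoin []             = e , e
conjoin ((s , t) ∷ es) = pairₜ s (proj₁ (conjoin es)) , pairₜ t (proj₂ (conjoin es))

AllVarsₑ : (Var → Set) → Term × Term → Set
AllVarsₑ P (s , t) = AllVarsₜ P s × AllVarsₜ P t

conjoin-vars : ∀ {P : Var → Set} es → All (AllVarsₑ P) es → AllVarsₑ P (conjoin es)
conjoin-vars []             []                = _ , _
conjoin-vars ((s , t) ∷ es) ((ps , pt) ∷ pes) =
  pairₜ-vars s (proj₁ (conjoin es)) ps (proj₁ (conjoin-vars es pes)) ,
  pairₜ-vars t (proj₂ (conjoin es)) pt (proj₂ (conjoin-vars es pes))

conjoin-⊨ : ∀ es → (ρ ⊨ equation (conjoin es)) ⇔ All (λ st → ρ ⊨ equation st) es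
conjoin-⊨ []             = mk⇔ (λ _ → []) (λ _ → refl)
conjoin-⊨ ((s , t) ∷ es) = mk⇔
  (λ h → let s≡t , rest = to (pairₜ-⊨ s t (proj₁ (conjoin es)) (proj₂ (conjoin es))) h in s≡t ∷ to (conjoin-⊨ es) rest)
  (λ { (s≡t ∷ rest) → from (pairₜ-⊨ s t (proj₁ (conjoin es)) (proj₂ (conjoin es))) (s≡t , from (conjoin-⊨ es) rest) })

guardₜ : (z a b p s : Term) → List (Term × Term)
guardₜ z a b p s = (p ∘ₜ z , z ∘ₜ p) ∷ (s ∘ₜ z , z ∘ₜ s) ∷ (p ∘ₜ (c0 ∘ₜ (a ∘ₜ c0)) , c0 ∘ₜ (b ∘ₜ (c0 ∘ₜ s))) ∷ []

guardₜ-vars : ∀ {P : Var → Set} z a b p s → AllVarsₜ P z → AllVarsₜ P a → AllVarsₜ P b →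
              AllVarsₜ P p → AllVarsₜ P s → All (AllVarsₑ P) (guardₜ z a b p s)
guardₜ-vars z a b p s pz pa pb pp ps = ((pp , pz) , pz , pp) ∷ ((ps , pz) , pz , ps) ∷ ((pp , _ , pa , _) , _ , pb , _ , ps) ∷ []

orSystemₜ : (a b c d : Term) → Var → List (Term × Term)
orSystemₜ a b c d k =
  (var k ∘ₜ var (1 + k) , c1) ∷ guardₜ (var k) a b (var (2 + k)) (var (3 + k)) ++ guardₜ (var (1 + k)) c d (var (4 + k)) (var (5 + k))

orSystemₜ-vars : ∀ {P : Var → Set} a b c d k → AllVarsₜ P a → AllVarsₜ P b → AllVarsₜ P c → AllVarsₜ P d →
                 (∀ {i} → i < 6 → P (i + k)) → All (AllVarsₑ P) (orSystemₜ a b c d k)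
orSystemₜ-vars a b c d k pa pb pc pd fresh =
  ((fresh z<s , fresh (s<s z<s)) , _) ∷
  ++⁺ (guardₜ-vars (var k) a b (var (2 + k)) (var (3 + k)) (fresh z<s) pa pb
         (fresh (s<s (s<s z<s))) (fresh (s<s (s<s (s<s z<s)))))
      (guardₜ-vars (var (1 + k)) c d (var (4 + k)) (var (5 + k)) (fresh (s<s z<s)) pc pd
         (fresh (s<s (s<s (s<s (s<s z<s))))) (fresh (s<s (s<s (s<s (s<s (s<s z<s)))))))

orSystem-cong : ∀ {A A′ B B′ C C′ D D′ Z Z′ W W′ P P′ S S′ P₁ P₁′ S₁ S₁′} →
  A ≡ A′ → B ≡ B′ → C ≡ C′ → D ≡ D′ → Z ≡ Z′ → W ≡ W′ → P ≡ P′ → S ≡ S′ → P₁ ≡ P₁′ → S₁ ≡ S₁′ →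
  orSystem A B C D Z W P S P₁ S₁ ≡ orSystem A′ B′ C′ D′ Z′ W′ P′ S′ P₁′ S₁′
orSystem-cong refl refl refl refl refl refl refl refl refl refl = refl

evalₑ : Assignment → Term × Term → BitString × BitString
evalₑ ρ (s , t) = ⟦ s ⟧ₜ ρ , ⟦ t ⟧ₜ ρ

∨-as-∃ : ∀ a b c d k → AllVarsₜ (_< k) a → AllVarsₜ (_< k) b → AllVarsₜ (_< k) c → AllVarsₜ (_< k) d →
         ((a ≐ b) ∨ᶠ (c ≐ d)) ≡𝔇 applyQuants (exists-from k 6) (equation (conjoin (orSystemₜ a b c d k)))
∨-as-∃ a b c d k a<k b<k c<k d<k ρ =
  ⇔-trans (or-encoding _ _ _ _)
    (∃-⇔ λ {Z} → ∃-⇔ λ {W} → ∃-⇔ λ {P} → ∃-⇔ λ {S} → ∃-⇔ λ {P₁} → ∃-⇔ λ {S₁} → ⇔-sym (system-⊨ Z W P S P₁ S₁))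
  where
  system-⊨ : ∀ Z W P S P₁ S₁ →
    (updates ρ k (Z ∷ W ∷ P ∷ S ∷ P₁ ∷ S₁ ∷ []) ⊨ equation (conjoin (orSystemₜ a b c d k))) ⇔
    Solves (orSystem (⟦ a ⟧ₜ ρ) (⟦ b ⟧ₜ ρ) (⟦ c ⟧ₜ ρ) (⟦ d ⟧ₜ ρ) Z W P S P₁ S₁)
  system-⊨ Z W P S P₁ S₁ =
    ⇔-trans (conjoin-⊨ (orSystemₜ a b c d k)) (⇔-trans (mk⇔ (map⁺ {f = evalₑ σ}) map⁻) (≡⇒⇔ (cong Solves
      (orSystem-cong (unchanged a a<k) (unchanged b b<k) (unchanged c c<k) (unchanged d d<k)
        (updates-lookup ρ k zs zero) (updates-lookup ρ k zs (suc zero)) (updates-lookup ρ k zs (suc (suc zero)))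
        (updates-lookup ρ k zs (suc (suc (suc zero)))) (updates-lookup ρ k zs (suc (suc (suc (suc zero)))))
        (updates-lookup ρ k zs (suc (suc (suc (suc (suc zero))))))))))
    where
    zs : List BitString
    zs = Z ∷ W ∷ P ∷ S ∷ P₁ ∷ S₁ ∷ []
    σ : Assignment
    σ = updates ρ k zs
    unchanged : ∀ x → AllVarsₜ (_< k) x → ⟦ x ⟧ₜ σ ≡ ⟦ x ⟧ₜ ρ
    unchanged x x<k = ⟦⟧ₜ-coincidence x x<k (updates-< ρ zs)

≼-as-∃ : ∀ s t z → z #ₜ s → z #ₜ t → (s ≼ t) ≡𝔇 ∃ᶠ z ((s ∘ₜ var z) ≐ t)
≼-as-∃ s t z z#s z#t ρ = ∃-⇔ λ {U} →
  ≡⇒⇔ (cong₂ _≡_ (cong₂ _++_ (sym (⟦⟧ₜ-update-# s U z#s)) (sym (update-≡ ρ z U))) (sym (⟦⟧ₜ-update-# t U z#t)))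

-- Under ρ this is NotPrefixVia ⟦ s ⟧ ⟦ t ⟧ (ρ k) (ρ (1 + k)) (ρ (2 + k)).
notPrefixBody : Term → Term → Var → Formula
notPrefixBody s t k =
  ((s ≐ (p ∘ₜ (c0 ∘ₜ q))) ∧ᶠ (t ≐ (p ∘ₜ (c1 ∘ₜ r)))) ∨ᶠ (((s ≐ (p ∘ₜ (c1 ∘ₜ q))) ∧ᶠ (t ≐ (p ∘ₜ (c0 ∘ₜ r)))) ∨ᶠ
  ((s ≐ (t ∘ₜ (c0 ∘ₜ q))) ∨ᶠ (s ≐ (t ∘ₜ (c1 ∘ₜ q)))))
  where
  p q r : Term
  p = var k
  q = var (1 + k)
  r = var (2 + k)

notPrefixFormula : Term → Term → Var → Formula
notPrefixFormula s t k = applyQuants (exists-from k 3) (notPrefixBody s t k)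

NotPrefixVia-cong : ∀ {S S′ T T′ P P′ Q Q′ R R′} → S ≡ S′ → T ≡ T′ → P ≡ P′ → Q ≡ Q′ → R ≡ R′ →
                    NotPrefixVia S T P Q R ≡ NotPrefixVia S′ T′ P′ Q′ R′
NotPrefixVia-cong refl refl refl refl refl = refl

⋠-as-∃ : ∀ s t k → AllVarsₜ (_< k) s → AllVarsₜ (_< k) t →
          (¬ᶠ (s ≼ t)) ≡𝔇 notPrefixFormula s t k
⋠-as-∃ s t k s<k t<k ρ =
  ⇔-trans (⋢⇔NotPrefix _ _) (∃-⇔ λ {P} → ∃-⇔ λ {Q} → ∃-⇔ λ {R} → ⇔-sym (≡⇒⇔ (NotPrefixVia-cong
    (unchanged (P ∷ Q ∷ R ∷ []) s s<k) (unchanged (P ∷ Q ∷ R ∷ []) t t<k) (updates-lookup ρ k (P ∷ Q ∷ R ∷ []) zero)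
    (updates-lookup ρ k (P ∷ Q ∷ R ∷ []) (suc zero)) (updates-lookup ρ k (P ∷ Q ∷ R ∷ []) (suc (suc zero))))))
  where
  unchanged : ∀ zs x → AllVarsₜ (_< k) x → ⟦ x ⟧ₜ (updates ρ k zs) ≡ ⟦ x ⟧ₜ ρ
  unchanged zs x x<k = ⟦⟧ₜ-coincidence x x<k (updates-< ρ zs)

-- Positive formulas

data Fragment : Set where
  sigma existential : Fragment

data Positive : Fragment → Formula → Set where
  atom : ∀ {f} s t → Positive f (s ≐ t)
  _∧⁺_ : ∀ {f φ ψ} → Positive f φ → Positive f ψ → Positive f (φ ∧ᶠ ψ)
  _∨⁺_ : ∀ {f φ ψ} → Positive f φ → Positive f ψ → Positive f (φ ∨ᶠ ψ)
  ∃⁺   : ∀ {f φ} x → Positive f φ → Positive f (∃ᶠ x φ)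
  ∀≼⁺  : ∀ {φ} x t → ¬ OccursIn x t → Positive sigma φ → Positive sigma (∀≼ x t φ)

record PositiveForm (f : Fragment) (φ : Formula) : Set where
  constructor positiveForm
  field
    formula    : Formula
    positive   : Positive f formula
    equivalent : φ ≡𝔇 formula

module _ {f : Fragment} where

  ≐-form : ∀ s t → PositiveForm f (s ≐ t)
  ≐-form s t = positiveForm (s ≐ t) (atom s t) λ _ → ⇔-refl

  ≼-form : ∀ s t → PositiveForm f (s ≼ t)
  ≼-form s t = positiveForm (∃ᶠ z ((s ∘ₜ var z) ≐ t)) (∃⁺ z (atom _ _))
               (≼-as-∃ s t z (<⇒#ₜ s ≤-refl (below-freshˡ s t)) (<⇒#ₜ t ≤-refl (below-freshʳ s t)))
    where z = fresh s t

  notPrefixFormula-positive : ∀ s t k → Positive f (notPrefixFormula s t k)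
  notPrefixFormula-positive s t k =
    ∃⁺ _ (∃⁺ _ (∃⁺ _ ((atom _ _ ∧⁺ atom _ _) ∨⁺ ((atom _ _ ∧⁺ atom _ _) ∨⁺ (atom _ _ ∨⁺ atom _ _)))))

  ⋠-form : ∀ s t → PositiveForm f (¬ᶠ (s ≼ t))
  ⋠-form s t = positiveForm (notPrefixFormula s t k) (notPrefixFormula-positive s t k)
               (⋠-as-∃ s t k (below-freshˡ s t) (below-freshʳ s t))
    where k = fresh s t

  ≢-form : ∀ s t → PositiveForm f (¬ᶠ (s ≐ t))
  ≢-form s t = positiveForm (notPrefixFormula s t k ∨ᶠ notPrefixFormula t s k)
               (notPrefixFormula-positive s t k ∨⁺ notPrefixFormula-positive t s k)
               λ ρ → ⇔-trans (≢⇔⋢⊎⋣ _ _)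
                 (⋠-as-∃ s t k (below-freshˡ s t) (below-freshʳ s t) ρ ⊎-⇔ ⋠-as-∃ t s k (below-freshʳ s t) (below-freshˡ s t) ρ)
    where k = fresh s t

  ∧-form : ∀ {φ ψ} → PositiveForm f φ → PositiveForm f ψ → PositiveForm f (φ ∧ᶠ ψ)
  ∧-form (positiveForm φ′ p φ≡φ′) (positiveForm ψ′ q ψ≡ψ′) =
    positiveForm (φ′ ∧ᶠ ψ′) (p ∧⁺ q) λ ρ → φ≡φ′ ρ ×-⇔ ψ≡ψ′ ρ

  ∨-form : ∀ {φ ψ} → PositiveForm f φ → PositiveForm f ψ → PositiveForm f (φ ∨ᶠ ψ)
  ∨-form (positiveForm φ′ p φ≡φ′) (positiveForm ψ′ q ψ≡ψ′) =
    positiveForm (φ′ ∨ᶠ ψ′) (p ∨⁺ q) λ ρ → φ≡φ′ ρ ⊎-⇔ ψ≡ψ′ ρ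

  ∃-form : ∀ x {φ} → PositiveForm f φ → PositiveForm f (∃ᶠ x φ)
  ∃-form x (positiveForm φ′ p φ≡φ′) = positiveForm (∃ᶠ x φ′) (∃⁺ x p) λ ρ → ∃-⇔ (φ≡φ′ _)

  ∃≼-form : ∀ x t {φ} → PositiveForm f φ → PositiveForm f (∃≼ x t φ)
  ∃≼-form x t φ⁺ = ∃-form x (∧-form (≼-form (var x) t) φ⁺)

∀≼-form : ∀ x t {φ} → ¬ OccursIn x t → PositiveForm sigma φ → PositiveForm sigma (∀≼ x t φ)
∀≼-form x t x∉t (positiveForm φ′ p φ≡φ′) =
  positiveForm (∀≼ x t φ′) (∀≼⁺ x t x∉t p) λ ρ → Π-⇔ (→-cong-⇔ ⇔-refl (φ≡φ′ _))

Σ⇒Positive : ∀ {φ} → IsΣ φ → PositiveForm sigma φ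
Σ⇒Positive (eq s t)         = ≐-form s t
Σ⇒Positive (pre s t)        = ≼-form s t
Σ⇒Positive (neq s t)        = ≢-form s t
Σ⇒Positive (npre s t)       = ⋠-form s t
Σ⇒Positive (and φ ψ)        = ∧-form (Σ⇒Positive φ) (Σ⇒Positive ψ)
Σ⇒Positive (or φ ψ)         = ∨-form (Σ⇒Positive φ) (Σ⇒Positive ψ)
Σ⇒Positive (bex x t _ φ)    = ∃≼-form x t (Σ⇒Positive φ)
Σ⇒Positive (ball x t x∉t φ) = ∀≼-form x t x∉t (Σ⇒Positive φ)
Σ⇒Positive (ex x φ)         = ∃-form x (Σ⇒Positive φ)

PureEx⇒Positive : ∀ {φ} → IsPureEx φ → PositiveForm existential φ
PureEx⇒Positive (eq s t)      = ≐-form s t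
PureEx⇒Positive (pre s t)     = ≼-form s t
PureEx⇒Positive (neq s t)     = ≢-form s t
PureEx⇒Positive (npre s t)    = ⋠-form s t
PureEx⇒Positive (and φ ψ)     = ∧-form (PureEx⇒Positive φ) (PureEx⇒Positive ψ)
PureEx⇒Positive (or φ ψ)      = ∨-form (PureEx⇒Positive φ) (PureEx⇒Positive ψ)
PureEx⇒Positive (bex x t _ φ) = ∃≼-form x t (PureEx⇒Positive φ)
PureEx⇒Positive (ex x φ)      = ∃-form x (PureEx⇒Positive φ)

-- Prenex normal forms

Allowed : Fragment → Quant → Set
Allowed _           (qEx _) = ⊤
Allowed sigma       _       = ⊤
Allowed existential _       = ⊥

-- The prenex form of φ with its free variables renamed by σ, whose bound variables are
-- taken from n onwards.
record Prenex (f : Fragment) (n : ℕ) (σ : Var → Var) (φ : Formula) : Set where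
  field
    prefix        : List Quant
    lhs rhs       : Term
    next          : ℕ
    n≤next        : n ≤ next
    sound         : ∀ ρ → (ρ ⊨ applyQuants prefix (lhs ≐ rhs)) ⇔ ((ρ ∘ σ) ⊨ φ)
    binders-fresh : All (λ q → n ≤ binder q) prefix
    lhs<next      : AllVarsₜ (_< next) lhs
    rhs<next      : AllVarsₜ (_< next) rhs
    noncircular   : All NonCircular prefix
    allowed       : All (Allowed f) prefix

  normalForm : Formula
  normalForm = applyQuants prefix (lhs ≐ rhs)

open Prenex

MapsBelow : (Var → Var) → ℕ → Formula → Set
MapsBelow σ n φ = AllVars (λ y → σ y < n) φ

-- By soundness the normal form sees ρ only through ρ ∘ σ.
Prenex-Indep : ∀ {f m n σ φ v} (r : Prenex f m σ φ) → MapsBelow σ n φ → n ≤ v → Indep v (normalForm r)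
Prenex-Indep {σ = σ} {φ} r σφ<n n≤v ρ a = ⇔-trans (sound r _) (⇔-trans
  (⊨-coincidence φ σφ<n (λ σy<n → update-< ρ a (<-≤-trans σy<n n≤v))) (⇔-sym (sound r ρ)))

MapsBelow-mono : ∀ σ φ {m n} → m ≤ n → MapsBelow σ m φ → MapsBelow σ n φ
MapsBelow-mono σ φ m≤n = AllVars-mono (λ σy<m → <-≤-trans σy<m m≤n) φ

matrix-Indep : ∀ {f n σ φ} (r : Prenex f n σ φ) {v} → next r ≤ v → Indep v (lhs r ≐ rhs r)
matrix-Indep r next≤v = #⇒Indep (lhs r ≐ rhs r) (<⇒#ₜ (lhs r) next≤v (lhs<next r) , <⇒#ₜ (rhs r) next≤v (rhs<next r))

-- The second normal form draws its bound variables from where the first one stopped.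
module Juxtapose {f n σ φ ψ} (σψ<n : MapsBelow σ n ψ) (r₁ : Prenex f n σ φ) (r₂ : Prenex f (next r₁) σ ψ) where

  open Prenex r₁ public using () renaming (prefix to qs₁; lhs to s₁; rhs to t₁)
  open Prenex r₂ public using () renaming (prefix to qs₂; lhs to s₂; rhs to t₂; next to m)

  n≤m : n ≤ m
  n≤m = ≤-trans (n≤next r₁) (n≤next r₂)

  binders-fresh₁₂ : All (λ q → n ≤ binder q) (qs₁ ++ qs₂)
  binders-fresh₁₂ = ++⁺ (binders-fresh r₁) (All.map (≤-trans (n≤next r₁)) (binders-fresh r₂))

  noncircular₁₂ : All NonCircular (qs₁ ++ qs₂)
  noncircular₁₂ = ++⁺ (noncircular r₁) (noncircular r₂)

  allowed₁₂ : All (Allowed f) (qs₁ ++ qs₂)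
  allowed₁₂ = ++⁺ (allowed r₁) (allowed r₂)

  <m : ∀ t → AllVarsₜ (_< next r₁) t → AllVarsₜ (_< m) t
  <m = AllVarsₜ-mono (λ y< → <-≤-trans y< (n≤next r₂))

  private
    indep₁ : All (λ q → Indep (binder q) (normalForm r₂)) qs₁
    indep₁ = All.map (Prenex-Indep r₂ σψ<n) (binders-fresh r₁)
    indep₂ : All (λ q → Indep (binder q) (s₁ ≐ t₁)) qs₂
    indep₂ = All.map (matrix-Indep r₁) (binders-fresh r₂)

  ∧-sound : ∀ ρ → (ρ ⊨ applyQuants (qs₁ ++ qs₂) ((s₁ ≐ t₁) ∧ᶠ (s₂ ≐ t₂))) ⇔ ((ρ ∘ σ) ⊨ (φ ∧ᶠ ψ))
  ∧-sound ρ = ⇔-trans (⇔-sym (∧-prenex qs₁ qs₂ indep₁ indep₂ ρ)) (sound r₁ ρ ×-⇔ sound r₂ ρ)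

  ∨-sound : ∀ ρ → (ρ ⊨ applyQuants (qs₁ ++ qs₂) ((s₁ ≐ t₁) ∨ᶠ (s₂ ≐ t₂))) ⇔ ((ρ ∘ σ) ⊨ (φ ∨ᶠ ψ))
  ∨-sound ρ =
    ⇔-trans (⇔-sym (∨-prenex qs₁ qs₂ indep₁ indep₂ (noncircular r₁) (noncircular r₂) ρ)) (sound r₁ ρ ⊎-⇔ sound r₂ ρ)

∧-Prenex : ∀ {f n σ φ ψ} → MapsBelow σ n ψ → (r₁ : Prenex f n σ φ) → Prenex f (next r₁) σ ψ →
           Prenex f n σ (φ ∧ᶠ ψ)
∧-Prenex σψ<n r₁ r₂ = record
  { prefix        = qs₁ ++ qs₂
  ; lhs           = pairₜ s₁ s₂
  ; rhs           = pairₜ t₁ t₂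
  ; next          = m
  ; n≤next        = n≤m
  ; sound         = λ ρ → ⇔-trans (applyQuants-cong (qs₁ ++ qs₂) (λ _ → pairₜ-⊨ s₁ t₁ s₂ t₂) ρ) (∧-sound ρ)
  ; binders-fresh = binders-fresh₁₂
  ; lhs<next      = pairₜ-vars s₁ s₂ (<m s₁ (lhs<next r₁)) (lhs<next r₂)
  ; rhs<next      = pairₜ-vars t₁ t₂ (<m t₁ (rhs<next r₁)) (rhs<next r₂)
  ; noncircular   = noncircular₁₂
  ; allowed       = allowed₁₂
  }
  where open Juxtapose σψ<n r₁ r₂

∨-Prenex : ∀ {f n σ φ ψ} → MapsBelow σ n ψ → (r₁ : Prenex f n σ φ) → Prenex f (next r₁) σ ψ →
           Prenex f n σ (φ ∨ᶠ ψ)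
∨-Prenex {σ = σ} {φ} {ψ} σψ<n r₁ r₂ = record
  { prefix        = (qs₁ ++ qs₂) ++ exists-from m 6
  ; lhs           = proj₁ (conjoin system)
  ; rhs           = proj₂ (conjoin system)
  ; next          = 6 + m
  ; n≤next        = ≤-trans n≤m (m≤n+m m 6)
  ; sound         = λ ρ → begin
      ρ ⊨ applyQuants ((qs₁ ++ qs₂) ++ exists-from m 6) matrix              ≡⟨ cong (ρ ⊨_) (applyQuants-++ (qs₁ ++ qs₂) _ matrix) ⟩
      ρ ⊨ applyQuants (qs₁ ++ qs₂) (applyQuants (exists-from m 6) matrix) ∼⟨ applyQuants-cong (qs₁ ++ qs₂) (⇔-sym ∘ ∨-as-∃′) ρ ⟩
      ρ ⊨ applyQuants (qs₁ ++ qs₂) ((s₁ ≐ t₁) ∨ᶠ (s₂ ≐ t₂))                ∼⟨ ∨-sound ρ ⟩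
      (ρ ∘ σ) ⊨ (φ ∨ᶠ ψ)                                                     ∎
  ; binders-fresh = ++⁺ binders-fresh₁₂ (exists-from-All m 6 (≤-trans n≤m))
  ; lhs<next      = proj₁ system<next
  ; rhs<next      = proj₂ system<next
  ; noncircular   = ++⁺ noncircular₁₂ (exists-from-All m 6 _)
  ; allowed       = ++⁺ allowed₁₂ (exists-from-All m 6 _)
  }
  where
  open Juxtapose σψ<n r₁ r₂
  open EquationalReasoning
  system : List (Term × Term)
  system = orSystemₜ s₁ t₁ s₂ t₂ m
  matrix : Formula
  matrix = equation (conjoin system)
  ∨-as-∃′ : ((s₁ ≐ t₁) ∨ᶠ (s₂ ≐ t₂)) ≡𝔇 applyQuants (exists-from m 6) matrix
  ∨-as-∃′ = ∨-as-∃ s₁ t₁ s₂ t₂ m (<m s₁ (lhs<next r₁)) (<m t₁ (rhs<next r₁)) (lhs<next r₂) (rhs<next r₂)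
  <6+m : ∀ t → AllVarsₜ (_< m) t → AllVarsₜ (_< 6 + m) t
  <6+m = AllVarsₜ-mono (λ y< → <-≤-trans y< (m≤n+m m 6))
  system<next : AllVarsₑ (_< 6 + m) (conjoin system)
  system<next = conjoin-vars system (orSystemₜ-vars s₁ t₁ s₂ t₂ m
    (<6+m s₁ (<m s₁ (lhs<next r₁))) (<6+m t₁ (<m t₁ (rhs<next r₁))) (<6+m s₂ (lhs<next r₂)) (<6+m t₂ (rhs<next r₂))
    (+-monoˡ-< m))

extend : (Var → Var) → Var → Var → Var → Var
extend σ x n y with x ≟ y
... | yes _ = n
... | no _  = σ y

MapsBelow-extend : ∀ σ x φ {n} → MapsBelow σ n φ → MapsBelow (extend σ x n) (suc n) φ
MapsBelow-extend σ x φ {n} = AllVars-mono below φ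
  where
  below : ∀ {y} → σ y < n → extend σ x n y < suc n
  below {y} σy<n with x ≟ y
  ... | yes _ = n<1+n n
  ... | no _  = m<n⇒m<1+n σy<n

extend-update : ∀ {σ n} ρ x a → Agree (λ y → σ y < n) (update ρ n a ∘ extend σ x n) (update (ρ ∘ σ) x a)
extend-update {σ} {n} ρ x a {y} σy<n with x ≟ y
... | yes _ = update-≡ ρ n a
... | no _  = update-< ρ a σy<n

bound-variable-⇔ : ∀ {f n σ x φ} → MapsBelow σ n φ → (r : Prenex f (suc n) (extend σ x n) φ) →
                   ∀ ρ a → (update ρ n a ⊨ normalForm r) ⇔ (update (ρ ∘ σ) x a ⊨ φ)
bound-variable-⇔ {x = x} {φ} σφ<n r ρ a = ⇔-trans (sound r _) (⊨-coincidence φ σφ<n (extend-update ρ x a))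

∃-Prenex : ∀ {f n σ x φ} → MapsBelow σ n φ → Prenex f (suc n) (extend σ x n) φ → Prenex f n σ (∃ᶠ x φ)
∃-Prenex {n = n} {x = x} σφ<n r = record
  { prefix        = qEx n ∷ prefix r
  ; lhs           = lhs r
  ; rhs           = rhs r
  ; next          = next r
  ; n≤next        = <⇒≤ (n≤next r)
  ; sound         = λ ρ → ∃-⇔ (bound-variable-⇔ {x = x} σφ<n r ρ _)
  ; binders-fresh = ≤-refl ∷ All.map <⇒≤ (binders-fresh r)
  ; lhs<next      = lhs<next r
  ; rhs<next      = rhs<next r
  ; noncircular   = _ ∷ noncircular r
  ; allowed       = _ ∷ allowed r
  }

∀≼-Prenex : ∀ {n σ x t φ} → AllVarsₜ (λ y → σ y < n) t → ¬ OccursIn x t → MapsBelow σ n φ →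
            Prenex sigma (suc n) (extend σ x n) φ → Prenex sigma n σ (∀≼ x t φ)
∀≼-Prenex {n} {σ} {x} {t} σt<n x∉t σφ<n r = record
  { prefix        = qBAll n (renameₜ σ t) ∷ prefix r
  ; lhs           = lhs r
  ; rhs           = rhs r
  ; next          = next r
  ; n≤next        = <⇒≤ (n≤next r)
  ; sound         = λ ρ → Π-⇔ (→-cong-⇔ (bound-⇔ ρ _) (bound-variable-⇔ {x = x} σφ<n r ρ _))
  ; binders-fresh = ≤-refl ∷ All.map <⇒≤ (binders-fresh r)
  ; lhs<next      = lhs<next r
  ; rhs<next      = rhs<next r
  ; noncircular   = AllVarsₜ-renameₜ σ t (AllVarsₜ-mono (λ σy<n n≡σy → <⇒≢ σy<n (sym n≡σy)) t σt<n) ∷ noncircular r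
  ; allowed       = _ ∷ allowed r
  }
  where
  bound-⇔ : ∀ ρ a → (update ρ n a n ⊑ ⟦ renameₜ σ t ⟧ₜ (update ρ n a)) ⇔
                    (update (ρ ∘ σ) x a x ⊑ ⟦ t ⟧ₜ (update (ρ ∘ σ) x a))
  bound-⇔ ρ a = ≡⇒⇔ (cong₂ _⊑_ (trans (update-≡ ρ n a) (sym (update-≡ (ρ ∘ σ) x a))) (begin
    ⟦ renameₜ σ t ⟧ₜ (update ρ n a)   ≡⟨ ⟦renameₜ⟧ σ t ⟩
    ⟦ t ⟧ₜ (update ρ n a ∘ σ)         ≡⟨ ⟦⟧ₜ-coincidence t σt<n (λ σy<n → update-< ρ a σy<n) ⟩
    ⟦ t ⟧ₜ (ρ ∘ σ)                    ≡⟨ ⟦⟧ₜ-update-# t a (¬OccursIn⇒AllVarsₜ t x∉t) ⟨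
    ⟦ t ⟧ₜ (update (ρ ∘ σ) x a)       ∎))
    where open ≡-Reasoning

prenex : ∀ {f φ} → Positive f φ → ∀ n σ → MapsBelow σ n φ → Prenex f n σ φ
prenex (atom s t) n σ (σs<n , σt<n) = record
  { prefix        = []
  ; lhs           = renameₜ σ s
  ; rhs           = renameₜ σ t
  ; next          = n
  ; n≤next        = ≤-refl
  ; sound         = λ ρ → ≡⇒⇔ (cong₂ _≡_ (⟦renameₜ⟧ σ s) (⟦renameₜ⟧ σ t))
  ; binders-fresh = []
  ; lhs<next      = AllVarsₜ-renameₜ σ s σs<n
  ; rhs<next      = AllVarsₜ-renameₜ σ t σt<n
  ; noncircular   = []
  ; allowed       = []
  }
prenex {φ = _ ∧ᶠ ψ} (p ∧⁺ q) n σ (σφ<n , σψ<n) =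
  ∧-Prenex σψ<n r (prenex q (next r) σ (MapsBelow-mono σ ψ (n≤next r) σψ<n))
  where r = prenex p n σ σφ<n
prenex {φ = _ ∨ᶠ ψ} (p ∨⁺ q) n σ (σφ<n , σψ<n) =
  ∨-Prenex σψ<n r (prenex q (next r) σ (MapsBelow-mono σ ψ (n≤next r) σψ<n))
  where r = prenex p n σ σφ<n
prenex {φ = ∃ᶠ _ φ} (∃⁺ x p) n σ σφ<n =
  ∃-Prenex σφ<n (prenex p (suc n) (extend σ x n) (MapsBelow-extend σ x φ σφ<n))
prenex {φ = ∀ᶠ _ (_ ⇒ᶠ φ)} (∀≼⁺ x t x∉t p) n σ ((_ , σt<n) , σφ<n) =
  ∀≼-Prenex σt<n x∉t σφ<n (prenex p (suc n) (extend σ x n) (MapsBelow-extend σ x φ σφ<n))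

NormalForm : Fragment → Formula → Set
NormalForm f φ = Σ (List Quant) λ qs → Σ Term λ s → Σ Term λ t → φ ≡𝔇 applyQuants qs (s ≐ t) × All (Allowed f) qs

normalForm-of : ∀ {f φ} → PositiveForm f φ → NormalForm f φ
normalForm-of (positiveForm ψ ψ⁺ φ≡ψ) = prefix r , lhs r , rhs r , (λ ρ → ⇔-trans (φ≡ψ ρ) (⇔-sym (sound r ρ))) , allowed r
  where
  r : Prenex _ (suc (maxVar ψ)) id ψ
  r = prenex ψ⁺ (suc (maxVar ψ)) id (AllVars-mono s≤s ψ (AllVars-≤maxVar ψ))

existentials : ∀ qs → All (Allowed existential) qs → Σ (List Var) λ vs → ∀ φ → applyQuants qs φ ≡ existsAll vs φ
existentials []           []       = [] , λ _ → refl
existentials (qEx v ∷ qs) (_ ∷ ok) with vs , qs≡vs ← existentials qs ok = v ∷ vs , λ φ → cong (∃ᶠ v) (qs≡vs φ)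

theorem8 : ((φ : Formula) → IsΣ φ →
               Σ (List Quant) (λ qs → Σ Term (λ s → Σ Term (λ t →
                 φ ≡𝔇 applyQuants qs (s ≐ t)))))
             × ((φ : Formula) → IsPureEx φ →
               Σ (List Var) (λ vs → Σ Term (λ s → Σ Term (λ t →
                 φ ≡𝔇 existsAll vs (s ≐ t)))))
theorem8 = sigma-case , existential-case
  where
  sigma-case : (φ : Formula) → IsΣ φ →
               Σ (List Quant) (λ qs → Σ Term (λ s → Σ Term (λ t → φ ≡𝔇 applyQuants qs (s ≐ t))))
  sigma-case φ φ∈Σ with qs , s , t , φ≡ , _ ← normalForm-of (Σ⇒Positive φ∈Σ) = qs , s , t , φ≡
  existential-case : (φ : Formula) → IsPureEx φ →
                     Σ (List Var) (λ vs → Σ Term (λ s → Σ Term (λ t → φ ≡𝔇 existsAll vs (s ≐ t))))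
  existential-case φ φ∈∃ with qs , s , t , φ≡ , ok ← normalForm-of (PureEx⇒Positive φ∈∃)
                           with vs , qs≡vs ← existentials qs ok =
    vs , s , t , λ ρ → ⇔-trans (φ≡ ρ) (≡⇒⇔ (cong (ρ ⊨_) (qs≡vs (s ≐ t))))
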